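{- Let $P$ be a disjunctive definite program and let $I_1, I_2, T$ be sets of ground user-defined atoms with $I_1\cap T=I_2\cap T=\emptyset$. If $\langle I_1,T\rangle$ and $\langle I_2,T\rangle$ are models of $P$, then $\langle I_1\cap I_2,T\rangle$ is a model of $P$.
   Context: A disjunctive definite program $P$ consists of one clause per user-defined predicate $p$, of the form $p(V_1,\dots,V_n)\leftarrow (B_1\vee\dots\vee B_k)$, where $V_1,\dots,V_n$ are distinct variables (head variables) and each disjunct $B_j$ is a conjunction consisting of equality atoms $V_1=T_1,\dots,V_n=T_n$ ($T_i$ terms) followed by user-defined atoms; other variables are local variables. Ground atoms are over the Herbrand universe of the program. An interpretation maps each ground user-defined atom to one of the truth values $\mathbf{T}$ (true), $\mathbf{F}$ (false), $\mathbf{I}$ (inadmissible); a ground equality atom $s=t$ is always $\mathbf{T}$ if $s$ and $t$ are syntactically identical and $\mathbf{F}$ otherwise. For disjoint sets $I,T$ of ground user-defined atoms, $\langle I,T\rangle$ denotes the interpretation mapping atoms of $I$ to $\mathbf{I}$, atoms of $T$ to $\mathbf{T}$, and all other ground user-defined atoms to $\mathbf{F}$. Conjunction and disjunction are evaluated with Kleene's strong three-valued logic: $\wedge$ is $\mathbf{F}$ if some argument is $\mathbf{F}$, else $\mathbf{I}$ if some argument is $\mathbf{I}$, else $\mathbf{T}$; $\vee$ is $\mathbf{T}$ if some argument is $\mathbf{T}$, else $\mathbf{I}$ if some argument is $\mathbf{I}$, else $\mathbf{F}$. An interpretation is a model of $P$ if there is no ground instance (all variables replaced by ground terms) $H\leftarrow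 B$ of a clause of $P$ such that $H$ is $\mathbf{F}$ and $B$ is $\mathbf{T}$ or $\mathbf{I}$. -}

module Defs where

open import Data.Nat using (ℕ)
open import Data.Fin using (Fin)
open import Data.Bool using (Bool; true; false; if_then_else_; _∧_)
open import Data.Empty using (⊥)
open import Data.Sum using (_⊎_; inj₁; inj₂)
open import Data.Product using (Σ; _×_; _,_)
open import Data.List using (List; []; _∷_)
open import Data.Vec using (Vec; []; _∷_)
open import Relation.Nullary using (¬_; Dec; yes; no)
open import Relation.Binary.PropositionalEquality using (_≡_; refl; _≢_)
open import Relation.Binary.Definitions using (DecidableEquality)

data TV : Set where
  𝐓 𝐅 𝐈 : TV

_∧ₖ_ : TV → TV → TV
𝐅 ∧ₖ _ = 𝐅
_ ∧ₖ 𝐅 = 𝐅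
𝐈 ∧ₖ _ = 𝐈
_ ∧ₖ 𝐈 = 𝐈
𝐓 ∧ₖ 𝐓 = 𝐓

_∨ₖ_ : TV → TV → TV
𝐓 ∨ₖ _ = 𝐓
_ ∨ₖ 𝐓 = 𝐓
𝐈 ∨ₖ _ = 𝐈
_ ∨ₖ 𝐈 = 𝐈
𝐅 ∨ₖ 𝐅 = 𝐅

⋀ : List TV → TV
⋀ []       = 𝐓
⋀ (v ∷ vs) = v ∧ₖ ⋀ vs

⋁ : List TV → TV
⋁ []       = 𝐅
⋁ (v ∷ vs) = v ∨ₖ ⋁ vs

record Signature : Set₁ where
  field
    Fun    : Set
    arity  : Fun → ℕ
    _≟F_   : DecidableEquality Fun
    Pred   : Set
    parity : Pred → ℕ

module _ (S : Signature) where
  open Signature S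

  data Term (V : Set) : Set where
    var : V → Term V
    fn  : (f : Fun) → Vec (Term V) (arity f) → Term V

  GTerm : Set
  GTerm = Term ⊥

  GAtom : Set
  GAtom = Σ Pred (λ p → Vec GTerm (parity p))

  mutual
    inst : {V : Set} → (V → GTerm) → Term V → GTerm
    inst σ (var x)   = σ x
    inst σ (fn f ts) = fn f (instVec σ ts)

    instVec : {V : Set} {n : ℕ} → (V → GTerm) → Vec (Term V) n → Vec GTerm n
    instVec σ []       = []
    instVec σ (t ∷ ts) = inst σ t ∷ instVec σ ts

  mutual
    eqTerm : (s t : GTerm) → Bool
    eqTerm (var ()) _
    eqTerm (fn f ss) (var ())
    eqTerm (fn f ss) (fn g ts) with f ≟F g
    ... | yes refl = eqVec ss ts
    ... | no _     = false

    eqVec : {n : ℕ} → Vec GTerm n → Vec GTerm n → Bool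
    eqVec []       []       = true
    eqVec (s ∷ ss) (t ∷ ts) = eqTerm s t ∧ eqVec ss ts

  evalEq : GTerm → GTerm → TV
  evalEq s t = if eqTerm s t then 𝐓 else 𝐅

  -- Variables of the clause for predicate p: the head variables
  -- V_1..V_n (inj₁ i, i : Fin n, automatically distinct) and the local
  -- variables (inj₂ k, k : ℕ).
  Var : Pred → Set
  Var p = Fin (parity p) ⊎ ℕ

  record Atom (V : Set) : Set where
    constructor atom
    field
      pred : Pred
      args : Vec (Term V) (parity pred)

  -- a disjunct  V_1 = T_1, ..., V_n = T_n, A_1, ..., A_k
  record Disjunct (p : Pred) : Set where
    constructor disj
    field
      eqs   : Vec (Term (Var p)) (parity p)
      atoms : List (Atom (Var p))

  -- the clause  p(V_1,...,V_n) ← B_1 ∨ ... ∨ B_k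
  Clause : Pred → Set
  Clause p = List (Disjunct p)

  Program : Set
  Program = (p : Pred) → Clause p

  Interpretation : Set
  Interpretation = GAtom → TV

  headVars : {n : ℕ} → Vec (Fin n) n
  headVars = Data.Vec.allFin _

  groundHead : (p : Pred) → (Var p → GTerm) → GAtom
  groundHead p σ = p , Data.Vec.map (λ i → σ (inj₁ i)) headVars

  groundAtom : {V : Set} → (V → GTerm) → Atom V → GAtom
  groundAtom σ (atom q ts) = q , instVec σ ts

  evalEqs : {n : ℕ} → Vec GTerm n → Vec GTerm n → List TV
  evalEqs []       []       = []
  evalEqs (s ∷ ss) (t ∷ ts) = evalEq s t ∷ evalEqs ss ts

  evalDisjunct : Interpretation → (p : Pred) → (Var p → GTerm) → Disjunct p → TV
  evalDisjunct J p σ (disj eqs atoms) =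
    ⋀ (evalEqs (Data.Vec.map (λ i → σ (inj₁ i)) headVars) (instVec σ eqs)
       Data.List.++ Data.List.map (λ a → J (groundAtom σ a)) atoms)

  evalBody : Interpretation → (p : Pred) → (Var p → GTerm) → Clause p → TV
  evalBody J p σ c = ⋁ (Data.List.map (evalDisjunct J p σ) c)

  IsModel : Program → Interpretation → Set
  IsModel P J =
    (p : Pred) (σ : Var p → GTerm) →
    ¬ (J (groundHead p σ) ≡ 𝐅 × (evalBody J p σ (P p) ≡ 𝐓 ⊎ evalBody J p σ (P p) ≡ 𝐈))

  AtomSet : Set
  AtomSet = GAtom → Bool

  Disjoint : AtomSet → AtomSet → Set
  Disjoint A B = (a : GAtom) → A a ≡ true → B a ≡ true → ⊥

  _∩_ : AtomSet → AtomSet → AtomSet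
  (A ∩ B) a = A a ∧ B a

  ⟨_,_⟩ : AtomSet → AtomSet → Interpretation
  ⟨ I , T ⟩ a = if I a then 𝐈 else (if T a then 𝐓 else 𝐅)

{-# OPTIONS --safe #-}
module Submission where

open import Defs
open import Data.Nat using (ℕ; _≤_; z≤n; _⊓_; _⊔_)
open import Data.Nat.Properties using (≤-refl; ⊓-mono-≤; ⊔-mono-≤)
open import Data.Bool using (true; false)
open import Data.Empty using (⊥-elim)
open import Data.Sum using (_⊎_; inj₁; inj₂)
open import Data.Product using (_,_)
open import Data.List using (List; map)
import Data.Vec
open import Data.List.Relation.Binary.Pointwise as Pointwise using (Pointwise; []; _∷_)
open import Relation.Binary.PropositionalEquality using (_≡_; refl; sym; subst₂)

-- Kleene's connectives are min and max for the truth order F < I < T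
-- (encoded by rank), so lowering atoms in this order lowers every body.
-- Passing from ⟨ I₁ , T ⟩ or ⟨ I₂ , T ⟩ to ⟨ I₁ ∩ I₂ , T ⟩ lowers atoms
-- (I to F, and never out of T, by disjointness).  An atom that is F in
-- ⟨ I₁ ∩ I₂ , T ⟩ lies outside T and outside I₁ or I₂, so it is already F
-- in one of the two models, where its body is at least as high and hence
-- also F.

rank : TV → ℕ
rank 𝐅 = 0
rank 𝐈 = 1
rank 𝐓 = 2

rank-∧ₖ : ∀ a b → rank (a ∧ₖ b) ≡ rank a ⊓ rank b
rank-∧ₖ 𝐅 _ = refl
rank-∧ₖ 𝐈 𝐅 = refl
rank-∧ₖ 𝐈 𝐈 = refl
rank-∧ₖ 𝐈 𝐓 = refl
rank-∧ₖ 𝐓 𝐅 = refl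
rank-∧ₖ 𝐓 𝐈 = refl
rank-∧ₖ 𝐓 𝐓 = refl

rank-∨ₖ : ∀ a b → rank (a ∨ₖ b) ≡ rank a ⊔ rank b
rank-∨ₖ 𝐅 𝐅 = refl
rank-∨ₖ 𝐅 𝐈 = refl
rank-∨ₖ 𝐅 𝐓 = refl
rank-∨ₖ 𝐈 𝐅 = refl
rank-∨ₖ 𝐈 𝐈 = refl
rank-∨ₖ 𝐈 𝐓 = refl
rank-∨ₖ 𝐓 𝐅 = refl
rank-∨ₖ 𝐓 𝐈 = refl
rank-∨ₖ 𝐓 𝐓 = refl

infix 4 _≤ₖ_

_≤ₖ_ : TV → TV → Set
a ≤ₖ b = rank a ≤ rank b

∧ₖ-mono : ∀ {a a′ b b′} → a ≤ₖ a′ → b ≤ₖ b′ → a ∧ₖ b ≤ₖ a′ ∧ₖ b′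
∧ₖ-mono {a} {a′} {b} {b′} a≤a′ b≤b′ =
  subst₂ _≤_ (sym (rank-∧ₖ a b)) (sym (rank-∧ₖ a′ b′)) (⊓-mono-≤ a≤a′ b≤b′)

∨ₖ-mono : ∀ {a a′ b b′} → a ≤ₖ a′ → b ≤ₖ b′ → a ∨ₖ b ≤ₖ a′ ∨ₖ b′
∨ₖ-mono {a} {a′} {b} {b′} a≤a′ b≤b′ =
  subst₂ _≤_ (sym (rank-∨ₖ a b)) (sym (rank-∨ₖ a′ b′)) (⊔-mono-≤ a≤a′ b≤b′)

⋀-mono : ∀ {us vs} → Pointwise _≤ₖ_ us vs → ⋀ us ≤ₖ ⋀ vs
⋀-mono []            = ≤-refl
⋀-mono (u≤v ∷ us≤vs) = ∧ₖ-mono u≤v (⋀-mono us≤vs)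

⋁-mono : ∀ {us vs} → Pointwise _≤ₖ_ us vs → ⋁ us ≤ₖ ⋁ vs
⋁-mono []            = ≤-refl
⋁-mono (u≤v ∷ us≤vs) = ∨ₖ-mono u≤v (⋁-mono us≤vs)

map-≤ₖ : ∀ {A : Set} {f g : A → TV} → (∀ x → f x ≤ₖ g x) →
  ∀ xs → Pointwise _≤ₖ_ (map f xs) (map g xs)
map-≤ₖ {f = f} {g} f≤g xs = Pointwise.map⁺ f g (Pointwise.refl (λ {x} → f≤g x))

NonFalse : TV → Set
NonFalse a = a ≡ 𝐓 ⊎ a ≡ 𝐈

nonFalse-mono : ∀ {a b} → a ≤ₖ b → NonFalse a → NonFalse b
nonFalse-mono {b = 𝐓} _ _          = inj₁ refl
nonFalse-mono {b = 𝐈} _ _          = inj₂ refl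
nonFalse-mono {b = 𝐅} () (inj₁ refl)
nonFalse-mono {b = 𝐅} () (inj₂ refl)

module _ {S : Signature} where

  _≤ᴵ_ : Interpretation S → Interpretation S → Set
  J ≤ᴵ J′ = ∀ a → J a ≤ₖ J′ a

  evalDisjunct-mono : ∀ {J J′} → J ≤ᴵ J′ → ∀ p σ d →
    evalDisjunct S J p σ d ≤ₖ evalDisjunct S J′ p σ d
  evalDisjunct-mono J≤J′ p σ (disj eqs atoms) =
    ⋀-mono (Pointwise.++⁺ˡ ≤-refl headEquations
              (map-≤ₖ (λ a → J≤J′ (groundAtom S σ a)) atoms))
    where
    headEquations : List TV
    headEquations = evalEqs S (Data.Vec.map (λ i → σ (inj₁ i)) (headVars S)) (instVec S σ eqs)

  evalBody-mono : ∀ {J J′} → J ≤ᴵ J′ → ∀ p σ c →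
    evalBody S J p σ c ≤ₖ evalBody S J′ p σ c
  evalBody-mono J≤J′ p σ c =
    ⋁-mono (map-≤ₖ (evalDisjunct-mono J≤J′ p σ) c)

  isModel-lowerBound : ∀ {P J J₁ J₂} → J ≤ᴵ J₁ → J ≤ᴵ J₂ →
    (∀ a → J a ≡ 𝐅 → J₁ a ≡ 𝐅 ⊎ J₂ a ≡ 𝐅) →
    IsModel S P J₁ → IsModel S P J₂ → IsModel S P J
  isModel-lowerBound {P} J≤J₁ J≤J₂ 𝐅-below model₁ model₂ p σ (head≡𝐅 , body)
    with 𝐅-below _ head≡𝐅
  ... | inj₁ head₁≡𝐅 = model₁ p σ (head₁≡𝐅 , nonFalse-mono (evalBody-mono J≤J₁ p σ (P p)) body)
  ... | inj₂ head₂≡𝐅 = model₂ p σ (head₂≡𝐅 , nonFalse-mono (evalBody-mono J≤J₂ p σ (P p)) body)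

  _⊆_ : AtomSet S → AtomSet S → Set
  A ⊆ B = ∀ a → A a ≡ true → B a ≡ true

  ∩-⊆ˡ : ∀ I₁ I₂ → _∩_ S I₁ I₂ ⊆ I₁
  ∩-⊆ˡ I₁ _ a _ with I₁ a
  ... | true = refl

  ∩-⊆ʳ : ∀ I₁ I₂ → _∩_ S I₁ I₂ ⊆ I₂
  ∩-⊆ʳ I₁ _ a a∈I₁∩I₂ with I₁ a
  ... | true = a∈I₁∩I₂

  ⟨,⟩-monoˡ : ∀ {I I′ T} → I ⊆ I′ → Disjoint S I′ T → ⟨_,_⟩ S I T ≤ᴵ ⟨_,_⟩ S I′ T
  ⟨,⟩-monoˡ {I} {I′} {T} I⊆I′ I′∩T≡∅ a with I a in a∈I
  ... | true rewrite I⊆I′ a a∈I = ≤-refl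
  ... | false with I′ a in a∈I′ | T a in a∈T
  ...   | true  | true  = ⊥-elim (I′∩T≡∅ a a∈I′ a∈T)
  ...   | true  | false = z≤n
  ...   | false | _     = ≤-refl

  ⟨∩,⟩≡𝐅 : ∀ I₁ I₂ T a → ⟨_,_⟩ S (_∩_ S I₁ I₂) T a ≡ 𝐅 →
    ⟨_,_⟩ S I₁ T a ≡ 𝐅 ⊎ ⟨_,_⟩ S I₂ T a ≡ 𝐅
  ⟨∩,⟩≡𝐅 I₁ I₂ _ a a↦𝐅 with I₁ a | I₂ a
  ... | false | _     = inj₁ a↦𝐅
  ... | true  | false = inj₂ a↦𝐅

mainTheorem2 : (S : Signature) (P : Program S) (I₁ I₂ T : AtomSet S) →
    Disjoint S I₁ T → Disjoint S I₂ T →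
    IsModel S P (⟨_,_⟩ S I₁ T) → IsModel S P (⟨_,_⟩ S I₂ T) →
    IsModel S P (⟨_,_⟩ S (_∩_ S I₁ I₂) T)
mainTheorem2 S P I₁ I₂ T I₁∩T≡∅ I₂∩T≡∅ =
  isModel-lowerBound {P = P} (⟨,⟩-monoˡ (∩-⊆ˡ I₁ I₂) I₁∩T≡∅) (⟨,⟩-monoˡ (∩-⊆ʳ I₁ I₂) I₂∩T≡∅)
    (⟨∩,⟩≡𝐅 I₁ I₂ T)
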